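{- Let $p\ge 3$ be an integer, $t=2p-2$, and let $G$ be a simple undirected graph in which every vertex has degree at most $t+1$. Let $H_1$ and $H_2$ be two different $K^p_2$'s of $G$ with a common vertex. Then either (1) $H_1\cap H_2$ is isomorphic to $I_1\times K^{p-1}_2$, or (2) $H_1$ and $H_2$ have the same vertex set and at least two color classes of $H_1$ induce an edge in $G$.
   Context: $K^p_2$ is the complete $p$-partite graph with $p$ color classes of $2$ vertices each; a "$K^p_2$ of $G$" is a subgraph of $G$ (not necessarily induced) isomorphic to it; two are different if they are different subgraphs. $I_1$ is the graph with one vertex and no edges; for vertex-disjoint graphs $G_1,G_2$, $G_1\times G_2$ is their disjoint union together with all edges between $V(G_1)$ and $V(G_2)$. $H_1\cap H_2=(V(H_1)\cap V(H_2),E(H_1)\cap E(H_2))$. A color class $\{a,b\}$ induces an edge in $G$ if $(a,b)\in E(G)$. -}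

module Defs where

open import Data.Nat using (ℕ; _∸_)
open import Data.Bool using (Bool; true; false; not; _∧_; _∨_)
open import Data.Fin using (Fin; zero; suc; _≟_)
open import Data.Fin.Subset using (Subset; ∣_∣)
open import Data.Vec using (tabulate)
open import Data.Product using (Σ; ∃; _×_; _,_)
open import Data.Sum using (_⊎_; inj₁; inj₂)
open import Data.Unit using (⊤; tt)
open import Relation.Nullary using (¬_)
open import Relation.Nullary.Decidable using (⌊_⌋)
open import Relation.Binary.PropositionalEquality using (_≡_)
open import Function.Definitions using (Injective)

record SimpleGraph (n : ℕ) : Set where
  field
    adj     : Fin n → Fin n → Bool
    adj-sym : ∀ u v → adj u v ≡ adj v u
    irrefl  : ∀ v → adj v v ≡ false
open SimpleGraph public

degree : ∀ {n} → SimpleGraph n → Fin n → ℕ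
degree G u = ∣ tabulate (adj G u) ∣

record Subgraph {n : ℕ} (G : SimpleGraph n) : Set where
  field
    Vs    : Fin n → Bool
    Es    : Fin n → Fin n → Bool
    Es-sym : ∀ u v → Es u v ≡ Es v u
    Es⊆G  : ∀ u v → Es u v ≡ true → adj G u v ≡ true
    Es-ends : ∀ u v → Es u v ≡ true → (Vs u ≡ true × Vs v ≡ true)
open Subgraph public

SameSubgraph : ∀ {n} {G : SimpleGraph n} → Subgraph G → Subgraph G → Set
SameSubgraph H₁ H₂ = (∀ v → Vs H₁ v ≡ Vs H₂ v) × (∀ u v → Es H₁ u v ≡ Es H₂ u v)

∩V : ∀ {n} {G : SimpleGraph n} → Subgraph G → Subgraph G → Fin n → Bool
∩V H₁ H₂ v = Vs H₁ v ∧ Vs H₂ v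

∩E : ∀ {n} {G : SimpleGraph n} → Subgraph G → Subgraph G → Fin n → Fin n → Bool
∩E H₁ H₂ u v = Es H₁ u v ∧ Es H₂ u v

-- An isomorphism from an abstract graph (vertex type A, adjacency R) onto
-- the graph with vertex predicate V and edge predicate E inside Fin n:
-- a bijection f : A → {v | V v} preserving and reflecting adjacency.
IsoOnto : ∀ {n} (A : Set) (R : A → A → Bool)
          (V : Fin n → Bool) (E : Fin n → Fin n → Bool) → (A → Fin n) → Set
IsoOnto A R V E f =
  Injective _≡_ _≡_ f
  × (∀ a → V (f a) ≡ true)
  × (∀ v → V v ≡ true → ∃ λ a → f a ≡ v)
  × (∀ a b → E (f a) (f b) ≡ R a b)

Isomorphic : ∀ {n} (A : Set) (R : A → A → Bool)
             (V : Fin n → Bool) (E : Fin n → Fin n → Bool) → Set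
Isomorphic A R V E = Σ _ (IsoOnto A R V E)

-- K^p_2: vertices (i , a), i : Fin p the colour class, a : Fin 2;
-- adjacent iff in different colour classes.
K2-V : ℕ → Set
K2-V p = Fin p × Fin 2

K2-adj : ∀ p → K2-V p → K2-V p → Bool
K2-adj p (i , _) (j , _) = not ⌊ i ≟ j ⌋

-- I₁ × K: disjoint union with a new vertex joined to everything.
I₁×-V : Set → Set
I₁×-V A = ⊤ ⊎ A

I₁×-adj : ∀ {A : Set} → (A → A → Bool) → I₁×-V A → I₁×-V A → Bool
I₁×-adj R (inj₁ _) (inj₁ _) = false
I₁×-adj R (inj₁ _) (inj₂ _) = true
I₁×-adj R (inj₂ _) (inj₁ _) = true
I₁×-adj R (inj₂ x) (inj₂ y) = R x y

IsK2 : ∀ {n} {G : SimpleGraph n} → ℕ → Subgraph G → Set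
IsK2 p H = Isomorphic (K2-V p) (K2-adj p) (Vs H) (Es H)

-- A vertex of a K^p_2 H has 2p − 2 neighbours in H, so the degree bound 2p − 1 leaves it at most one
-- further neighbour in G. Suppose x ∈ V(H₁) ∖ V(H₂). Looking at a shared vertex, then at common
-- neighbours (p ≥ 3), any second vertex of V(H₁) ∖ V(H₂) would produce a vertex with two such extra
-- neighbours; the same argument shows that H₁ and H₂ induce the same edges on their shared vertices.
-- So H₁ ∩ H₂ is H₁ minus x, i.e. I₁ × K^{p−1}_2 with the partner of x as apex. If instead
-- V(H₁) = V(H₂), some vertex x has different partners in H₁ and H₂; each of them is then a neighbour
-- of x in the other copy, so the H₁-classes of x and of its H₂-partner both induce edges.

module Submission where

open import Defs
open import Data.Nat using (ℕ; zero; suc; _≤_; _∸_; _+_; _*_; z≤n; s≤s)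
open import Data.Nat.Properties using (≤-trans; ≤-reflexive; +-comm; *-comm; 1+n≰n)
open import Data.Bool using (Bool; true; false; not; _∧_)
import Data.Bool.Properties as Bool
open import Data.Fin using (Fin; zero; suc; _≟_; punchIn; punchOut; remQuot)
open import Data.Fin.Properties
  using (0≢1+n; suc-injective; punchIn-injective; punchInᵢ≢i; punchIn-punchOut; all?; ¬∀⟶∃¬; *↔×)
open import Data.Fin.Subset using (Subset; _∈_; _-_; ∣_∣)
open import Data.Fin.Subset.Properties using (x∈p∧x≢y⇒x∈p-y; x∈p⇒∣p-x∣<∣p∣)
open import Data.Vec using (tabulate)
open import Data.Vec.Properties using (lookup∘tabulate; lookup⇒[]=)
open import Data.Vec.Functional using (_∷_)
open import Data.Product using (Σ; ∃; ∃₂; _×_; _,_; proj₁; proj₂; swap)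
open import Data.Product.Properties using (,-injective; ,-injectiveˡ)
open import Data.Sum using (_⊎_; inj₁; inj₂)
open import Data.Unit using (tt)
open import Data.Empty using (⊥-elim)
open import Function using (_∘_; case_of_)
open import Function.Bundles using (Injection)
open import Function.Definitions using (Injective)
open import Function.Properties.Inverse using (↔⇒↣)
open import Relation.Nullary using (¬_; yes; no)
open import Relation.Nullary.Decidable using (⌊_⌋; decidable-stable)
open import Relation.Binary.PropositionalEquality

true≢false : ∀ {b} → b ≡ true → b ≢ false
true≢false refl ()

≢-by : ∀ {A : Set} (P : A → Bool) {a b} → P a ≡ true → P b ≡ false → a ≢ b
≢-by P Pa Pb refl = true≢false Pa Pb

∧-true : ∀ {b b′} → b ∧ b′ ≡ true → b ≡ true × b′ ≡ true
∧-true {true} {true} _ = refl , refl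

≡-by-implications : ∀ {b b′} → (b ≡ true → b′ ≡ true) → (b′ ≡ true → b ≡ true) → b ≡ b′
≡-by-implications {true}  {true}  _ _ = refl
≡-by-implications {false} {false} _ _ = refl
≡-by-implications {true}  {false} ⇒ _ = sym (⇒ refl)
≡-by-implications {false} {true}  _ ⇐ = ⇐ refl

≢-cases : ∀ {b b′ : Bool} → b ≢ b′ → (b ≡ true × b′ ≡ false) ⊎ (b ≡ false × b′ ≡ true)
≢-cases {true}  {true}  b≢b′ = ⊥-elim (b≢b′ refl)
≢-cases {true}  {false} _    = inj₁ (refl , refl)
≢-cases {false} {true}  _    = inj₂ (refl , refl)
≢-cases {false} {false} b≢b′ = ⊥-elim (b≢b′ refl)

differ-somewhere : ∀ {n} (E E′ : Fin n → Fin n → Bool) →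
                   ¬ (∀ u w → E u w ≡ E′ u w) → ∃₂ λ u w → E u w ≢ E′ u w
differ-somewhere E E′ E≉E′ with ¬∀⟶∃¬ _ _ (λ u → all? λ w → E u w Bool.≟ E′ u w) E≉E′
... | u , ¬∀w = u , ¬∀⟶∃¬ _ _ (λ w → E u w Bool.≟ E′ u w) ¬∀w

injective⇒≤∣p∣ : ∀ {k n} {p : Subset n} (g : Fin k → Fin n) →
                 Injective _≡_ _≡_ g → (∀ a → g a ∈ p) → k ≤ ∣ p ∣
injective⇒≤∣p∣ {zero}  g _ _ = z≤n
injective⇒≤∣p∣ {suc k} {p = p} g g-inj g∈p =
  ≤-trans (s≤s (injective⇒≤∣p∣ (g ∘ suc) (suc-injective ∘ g-inj) g∘suc∈p-g₀))
          (x∈p⇒∣p-x∣<∣p∣ (g∈p zero))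
  where
  g∘suc∈p-g₀ : ∀ a → g (suc a) ∈ p - g zero
  g∘suc∈p-g₀ a = x∈p∧x≢y⇒x∈p-y (g∈p (suc a)) (0≢1+n ∘ sym ∘ g-inj)

injective⇒≤degree : ∀ {k n} (G : SimpleGraph n) u (g : Fin k → Fin n) →
                    Injective _≡_ _≡_ g → (∀ a → adj G u (g a) ≡ true) → k ≤ degree G u
injective⇒≤degree G u g g-inj u~g =
  injective⇒≤∣p∣ {p = tabulate (adj G u)} g g-inj λ a → lookup⇒[]= (g a) _ (trans (lookup∘tabulate (adj G u) (g a)) (u~g a))

∷-injective : ∀ {A : Set} {k} {x : A} {g : Fin k → A} →
              Injective _≡_ _≡_ g → (∀ a → g a ≢ x) → Injective _≡_ _≡_ (x ∷ g)
∷-injective g-inj g≢x {zero}  {zero}  _  = refl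
∷-injective g-inj g≢x {zero}  {suc b} eq = ⊥-elim (g≢x b (sym eq))
∷-injective g-inj g≢x {suc a} {zero}  eq = ⊥-elim (g≢x a eq)
∷-injective g-inj g≢x {suc a} {suc b} eq = cong suc (g-inj eq)

other : Fin 2 → Fin 2
other zero       = suc zero
other (suc zero) = zero

other≢ : ∀ a → other a ≢ a
other≢ zero       ()
other≢ (suc zero) ()

≢⇒other : ∀ {a b : Fin 2} → b ≢ a → b ≡ other a
≢⇒other {zero}     {zero}     b≢a = ⊥-elim (b≢a refl)
≢⇒other {zero}     {suc zero} _   = refl
≢⇒other {suc zero} {zero}     _   = refl
≢⇒other {suc zero} {suc zero} b≢a = ⊥-elim (b≢a refl)

not-≟-refl : ∀ {p} {i : Fin p} → not ⌊ i ≟ i ⌋ ≡ false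
not-≟-refl {i = i} with i ≟ i
... | yes _  = refl
... | no i≢i = ⊥-elim (i≢i refl)

module _ {p : ℕ} {i j : Fin p} where

  not-≟-≢ : i ≢ j → not ⌊ i ≟ j ⌋ ≡ true
  not-≟-≢ i≢j with i ≟ j
  ... | yes i≡j = ⊥-elim (i≢j i≡j)
  ... | no _    = refl

  not-≟-true⇒≢ : not ⌊ i ≟ j ⌋ ≡ true → i ≢ j
  not-≟-true⇒≢ e refl = true≢false e not-≟-refl

  not-≟-false⇒≡ : not ⌊ i ≟ j ⌋ ≡ false → i ≡ j
  not-≟-false⇒≡ e with i ≟ j
  ... | yes i≡j = i≡j

third-class : ∀ {p} → 3 ≤ p → (i j : Fin p) → ∃ λ k → k ≢ i × k ≢ j
third-class (s≤s (s≤s (s≤s _))) i j with zero ≟ i | zero ≟ j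
... | no 0≢i | no 0≢j = zero , 0≢i , 0≢j
... | yes refl | _ with suc zero ≟ j
...   | no 1≢j   = suc zero , (λ ()) , 1≢j
...   | yes refl = suc (suc zero) , (λ ()) , (λ ())
third-class _ i j | no _ | yes refl with suc zero ≟ i
...   | no 1≢i   = suc zero , 1≢i , (λ ())
...   | yes refl = suc (suc zero) , (λ ()) , (λ ())

-- Deleting the vertex (c , a) from K^{m+1}_2 leaves I₁ × K^m_2, whose apex is (c , other a).
module _ {m : ℕ} (c : Fin (suc m)) (a : Fin 2) where

  embed : I₁×-V (K2-V m) → K2-V (suc m)
  embed (inj₁ _)       = c , other a
  embed (inj₂ (j , b)) = punchIn c j , b

  embed-injective : Injective _≡_ _≡_ embed
  embed-injective {inj₁ tt}      {inj₁ tt}      _  = refl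
  embed-injective {inj₁ _}       {inj₂ (j , _)} eq = ⊥-elim (punchInᵢ≢i c j (sym (,-injectiveˡ eq)))
  embed-injective {inj₂ (j , _)} {inj₁ _}       eq = ⊥-elim (punchInᵢ≢i c j (,-injectiveˡ eq))
  embed-injective {inj₂ (j , b)} {inj₂ (k , d)} eq with ,-injective eq
  ... | pj≡pk , refl = cong (λ l → inj₂ (l , b)) (punchIn-injective c j k pj≡pk)

  embed-≢ : ∀ k → embed k ≢ (c , a)
  embed-≢ (inj₁ _)       eq = other≢ a (proj₂ (,-injective eq))
  embed-≢ (inj₂ (j , _)) eq = punchInᵢ≢i c j (,-injectiveˡ eq)

  embed-onto : ∀ v → v ≢ (c , a) → ∃ λ k → embed k ≡ v
  embed-onto (i , b) v≢ca with i ≟ c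
  ... | no i≢c = inj₂ (punchOut (i≢c ∘ sym) , b) , cong (_, b) (punchIn-punchOut (i≢c ∘ sym))
  ... | yes refl with b ≟ a
  ...   | yes refl = ⊥-elim (v≢ca refl)
  ...   | no b≢a   = inj₁ tt , cong (c ,_) (sym (≢⇒other b≢a))

  embed-adj : ∀ k l → K2-adj (suc m) (embed k) (embed l) ≡ I₁×-adj (K2-adj m) k l
  embed-adj (inj₁ _)       (inj₁ _)       = not-≟-refl
  embed-adj (inj₁ _)       (inj₂ (j , _)) = not-≟-≢ (punchInᵢ≢i c j ∘ sym)
  embed-adj (inj₂ (j , _)) (inj₁ _)       = not-≟-≢ (punchInᵢ≢i c j)
  embed-adj (inj₂ (j , _)) (inj₂ (k , _)) with j ≟ k
  ... | yes refl = not-≟-refl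
  ... | no j≢k   = not-≟-≢ (j≢k ∘ punchIn-injective c j k)

K₂-minus-vertex : ∀ {n m} {V V′ : Fin n → Bool} {E E′ : Fin n → Fin n → Bool} {f : K2-V (suc m) → Fin n} →
  IsoOnto (K2-V (suc m)) (K2-adj (suc m)) V E f → ∀ c a →
  (∀ v → V′ v ≡ true → V v ≡ true) → V′ (f (c , a)) ≡ false →
  (∀ v → V v ≡ true → v ≢ f (c , a) → V′ v ≡ true) →
  (∀ u v → V′ u ≡ true → V′ v ≡ true → E′ u v ≡ E u v) →
  Isomorphic (I₁×-V (K2-V m)) (I₁×-adj (K2-adj m)) V′ E′
K₂-minus-vertex {n} {m} {V′ = V′} {E} {E′} {f} (f-inj , f∈V , f-onto , f-edge) c a V′⊆V x∉V′ V∖x⊆V′ E′≗E =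
  g , embed-injective c a ∘ f-inj , g∈V′ , g-onto , g-edge
  where
  g : I₁×-V (K2-V m) → Fin n
  g = f ∘ embed c a

  g∈V′ : ∀ k → V′ (g k) ≡ true
  g∈V′ k = V∖x⊆V′ _ (f∈V _) (embed-≢ c a k ∘ f-inj)

  g-onto : ∀ v → V′ v ≡ true → ∃ λ k → g k ≡ v
  g-onto v v∈V′ with f-onto v (V′⊆V v v∈V′)
  ... | w , refl with embed-onto c a w (λ { refl → true≢false v∈V′ x∉V′ })
  ...   | k , refl = k , refl

  g-edge : ∀ k l → E′ (g k) (g l) ≡ I₁×-adj (K2-adj m) k l
  g-edge k l = begin
    E′ (g k) (g l)                              ≡⟨ E′≗E _ _ (g∈V′ k) (g∈V′ l) ⟩
    E (g k) (g l)                               ≡⟨ f-edge _ _ ⟩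
    K2-adj (suc m) (embed c a k) (embed c a l)  ≡⟨ embed-adj c a k l ⟩
    I₁×-adj (K2-adj m) k l                      ∎
    where open ≡-Reasoning

Isomorphic-resp : ∀ {n} {A : Set} {R : A → A → Bool} {V V′ : Fin n → Bool} {E E′ : Fin n → Fin n → Bool} →
  (∀ v → V v ≡ V′ v) → (∀ u w → E u w ≡ E′ u w) → Isomorphic A R V E → Isomorphic A R V′ E′
Isomorphic-resp V≗V′ E≗E′ (g , g-inj , g∈V , g-onto , g-edge) =
  g , g-inj , (λ a → trans (sym (V≗V′ (g a))) (g∈V a)) , (λ v v∈V′ → g-onto v (trans (V≗V′ v) v∈V′)) ,
  (λ a b → trans (sym (E≗E′ (g a) (g b))) (g-edge a b))

module _ {n} {G : SimpleGraph n} (H : Subgraph G) where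

  Es-≢ : ∀ {x y} → Es H x y ≡ true → x ≢ y
  Es-≢ {x} e refl = true≢false (Es⊆G H x x e) (irrefl G x)

  Es-flip : ∀ {x y b} → Es H x y ≡ b → Es H y x ≡ b
  Es-flip {x} {y} e = trans (Es-sym H y x) e

  Es-outside : ∀ {x y} → Vs H y ≡ false → Es H x y ≡ false
  Es-outside {x} {y} y∉ with Es H x y in e
  ... | true  = ⊥-elim (true≢false (proj₂ (Es-ends H x y e)) y∉)
  ... | false = refl

  -- {x , y} is a colour class of H.
  Partners : Fin n → Fin n → Set
  Partners x y = Vs H x ≡ true × Vs H y ≡ true × x ≢ y × Es H x y ≡ false

  Partners-sym : ∀ {x y} → Partners x y → Partners y x
  Partners-sym (x∈ , y∈ , x≢y , xy∉) = y∈ , x∈ , x≢y ∘ sym , Es-flip xy∉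

  AtMostOneExtraNeighbour : Set
  AtMostOneExtraNeighbour = ∀ {x z z′} → Vs H x ≡ true → adj G x z ≡ true → adj G x z′ ≡ true →
                            Es H x z ≡ false → Es H x z′ ≡ false → z ≡ z′

module K₂Copy {n} {G : SimpleGraph n} {p} (H : Subgraph G) {f : K2-V p → Fin n}
  (iso : IsoOnto (K2-V p) (K2-adj p) (Vs H) (Es H) f) where

  f-injective : Injective _≡_ _≡_ f
  f-injective = proj₁ iso

  f∈H : ∀ v → Vs H (f v) ≡ true
  f∈H = proj₁ (proj₂ iso)

  f-onto : ∀ x → Vs H x ≡ true → ∃ λ v → f v ≡ x
  f-onto = proj₁ (proj₂ (proj₂ iso))

  f-edge : ∀ v w → Es H (f v) (f w) ≡ K2-adj p v w
  f-edge = proj₂ (proj₂ (proj₂ iso))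

  f-Partners : ∀ i a → Partners H (f (i , a)) (f (i , other a))
  f-Partners i a =
    f∈H _ , f∈H _ , (λ eq → other≢ a (sym (proj₂ (,-injective (f-injective eq))))) , trans (f-edge _ _) not-≟-refl

  partner-of-f : ∀ {i a y} → Partners H (f (i , a)) y → y ≡ f (i , other a)
  partner-of-f {i} {a} (_ , y∈ , x≢y , xy∉) with f-onto _ y∈
  ... | (j , b) , refl with not-≟-false⇒≡ (trans (sym (f-edge _ _)) xy∉)
  ...   | refl = cong (λ c → f (i , c)) (≢⇒other λ b≡a → x≢y (cong (λ c → f (i , c)) (sym b≡a)))

  partner-unique : ∀ {x y z} → Partners H x y → Partners H x z → y ≡ z
  partner-unique P@(x∈ , _) Q with f-onto _ x∈
  ... | _ , refl = trans (partner-of-f P) (sym (partner-of-f Q))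

  partner-exists : ∀ {x} → Vs H x ≡ true → ∃ (Partners H x)
  partner-exists x∈ with f-onto _ x∈
  ... | (i , a) , refl = _ , f-Partners i a

  partner-shares-neighbours : ∀ {x y w} → Partners H x y → Es H x w ≡ true → Es H y w ≡ true
  partner-shares-neighbours P@(x∈ , _) xw with f-onto _ x∈ | f-onto _ (proj₂ (Es-ends H _ _ xw))
  ... | (i , a) , refl | (k , c) , refl rewrite partner-of-f P =
    trans (f-edge _ _) (not-≟-≢ (not-≟-true⇒≢ (trans (sym (f-edge _ _)) xw)))

  non-partner-adjacent : ∀ {x y z} → Partners H x y → Vs H z ≡ true → x ≢ z → y ≢ z → Es H x z ≡ true
  non-partner-adjacent {x} {z = z} P@(x∈ , _) z∈ x≢z y≢z with Es H x z in xz
  ... | true  = refl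
  ... | false = ⊥-elim (y≢z (partner-unique P (x∈ , z∈ , x≢z , xz)))

  edge⇒classes-differ : ∀ {i j a b} → Es H (f (i , a)) (f (j , b)) ≡ true → i ≢ j
  edge⇒classes-differ e = not-≟-true⇒≢ (trans (sym (f-edge _ _)) e)

  class-edge : ∀ {i a y} → Partners H (f (i , a)) y → adj G (f (i , a)) y ≡ true →
               adj G (f (i , zero)) (f (i , suc zero)) ≡ true
  class-edge {a = zero}     P e = subst (λ y → adj G _ y ≡ true) (partner-of-f P) e
  class-edge {a = suc zero} P e = trans (adj-sym G _ _) (subst (λ y → adj G _ y ≡ true) (partner-of-f P) e)

  common-neighbour : 3 ≤ p → ∀ {x y} → Vs H x ≡ true → Vs H y ≡ true →
                     ∃ λ w → Es H x w ≡ true × Es H y w ≡ true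
  common-neighbour 3≤p x∈ y∈ with f-onto _ x∈ | f-onto _ y∈
  ... | (i , _) , refl | (j , _) , refl with third-class 3≤p i j
  ...   | k , k≢i , k≢j = f (k , zero) , trans (f-edge _ _) (not-≟-≢ (k≢i ∘ sym))
                                        , trans (f-edge _ _) (not-≟-≢ (k≢j ∘ sym))

-- Each vertex has 2m neighbours inside a K^{m+1}_2, so a degree bound of 2m + 1 leaves room for one more.
bounded-degree⇒AtMostOneExtraNeighbour :
  ∀ {n m} {G : SimpleGraph n} (H : Subgraph G) {f : K2-V (suc m) → Fin n} →
  IsoOnto (K2-V (suc m)) (K2-adj (suc m)) (Vs H) (Es H) f →
  (∀ v → degree G v ≤ m * 2 + 1) → AtMostOneExtraNeighbour H
bounded-degree⇒AtMostOneExtraNeighbour {n} {m} {G} H {f} iso deg {x} {z} {z′} x∈ xz xz′ xz∉ xz′∉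
  with K₂Copy.f-onto H iso x x∈
... | (i , a) , refl = decidable-stable (z ≟ z′) λ z≢z′ →
  1+n≰n (≤-trans (injective⇒≤degree G _ (z ∷ z′ ∷ nbr) (nbrs-injective z≢z′) x~nbrs)
                 (≤-trans (deg _) (≤-reflexive (+-comm (m * 2) 1))))
  where
  open K₂Copy H iso
  nbr : Fin (m * 2) → Fin n
  nbr k = f (punchIn i (proj₁ (remQuot {m} 2 k)) , proj₂ (remQuot {m} 2 k))

  nbr-edge : ∀ k → Es H (f (i , a)) (nbr k) ≡ true
  nbr-edge k = trans (f-edge _ _) (not-≟-≢ (punchInᵢ≢i i _ ∘ sym))

  nbr-injective : Injective _≡_ _≡_ nbr
  nbr-injective eq with ,-injective (f-injective eq)
  ... | pj≡pj′ , b≡b′ =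
    Injection.injective (↔⇒↣ (*↔× {m} {2})) (cong₂ _,_ (punchIn-injective i _ _ pj≡pj′) b≡b′)

  nbrs-injective : z ≢ z′ → Injective _≡_ _≡_ (z ∷ z′ ∷ nbr)
  nbrs-injective z≢z′ = ∷-injective (∷-injective nbr-injective (λ k → ≢-by (Es H _) (nbr-edge k) xz′∉))
    λ { zero → z≢z′ ∘ sym ; (suc k) → ≢-by (Es H _) (nbr-edge k) xz∉ }

  x~nbrs : ∀ k → adj G (f (i , a)) ((z ∷ z′ ∷ nbr) k) ≡ true
  x~nbrs zero          = xz
  x~nbrs (suc zero)    = xz′
  x~nbrs (suc (suc k)) = Es⊆G H _ _ (nbr-edge k)

module _ {n} {G : SimpleGraph n} (A B : Subgraph G) where

  Shared : Fin n → Set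
  Shared v = Vs A v ≡ true × Vs B v ≡ true

  Private : Fin n → Set
  Private v = Vs A v ≡ true × Vs B v ≡ false

compare-vertex-sets : ∀ {n} {G : SimpleGraph n} (A B : Subgraph G) →
                      (∀ v → Vs A v ≡ Vs B v) ⊎ ∃ (Private A B) ⊎ ∃ (Private B A)
compare-vertex-sets A B with all? (λ v → Vs A v Bool.≟ Vs B v)
... | yes V≗V′ = inj₁ V≗V′
... | no V≉V′ with ¬∀⟶∃¬ _ _ (λ v → Vs A v Bool.≟ Vs B v) V≉V′
...   | v , v-differs with ≢-cases v-differs
...     | inj₁ v-priv = inj₂ (inj₁ (v , v-priv))
...     | inj₂ v-priv = inj₂ (inj₂ (v , swap v-priv))

module PrivateVertex {n} {G : SimpleGraph n} {p} (3≤p : 3 ≤ p) (A B : Subgraph G) {f : K2-V p → Fin n}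
  (isoA : IsoOnto (K2-V p) (K2-adj p) (Vs A) (Es A) f) (B-extra : AtMostOneExtraNeighbour B) where

  open K₂Copy A isoA

  A-neighbours-off-B-unique : ∀ {u z z′} → Vs B u ≡ true → Es A u z ≡ true → Es A u z′ ≡ true →
                              Es B u z ≡ false → Es B u z′ ≡ false → z ≡ z′
  A-neighbours-off-B-unique u∈B uz uz′ = B-extra u∈B (Es⊆G A _ _ uz) (Es⊆G A _ _ uz′)

  shared-non-neighbour-partnered : ∀ {v c} → Shared A B v → Private A B c → Es A v c ≡ false → Partners A v c
  shared-non-neighbour-partnered (v∈A , v∈B) (c∈A , c∉B) vc = v∈A , c∈A , ≢-by (Vs B) v∈B c∉B , vc

  -- A common neighbour w of c and d is an A-neighbour outside B of w itself (if w ∈ B) or, through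
  -- the partner c, of v.
  private-vertex-unique-via-partner : ∀ {v c d} → Shared A B v → Private A B c → Private A B d →
                                      Es A v c ≡ false → Es A v d ≡ true → c ≡ d
  private-vertex-unique-via-partner {v} v-shared c-priv@(c∈A , c∉B) (d∈A , d∉B) vc vd
    with common-neighbour 3≤p c∈A d∈A
  ... | w , cw , dw with Vs B w in Bw
  ...   | true  = A-neighbours-off-B-unique Bw (Es-flip A cw) (Es-flip A dw) (Es-outside B c∉B) (Es-outside B d∉B)
  ...   | false = ⊥-elim (Es-≢ A dw
                    (A-neighbours-off-B-unique (proj₂ v-shared) vd vw (Es-outside B d∉B) (Es-outside B Bw)))
    where
    vw : Es A v w ≡ true
    vw = partner-shares-neighbours (Partners-sym A (shared-non-neighbour-partnered v-shared c-priv vc)) cw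

  private-vertex-unique : ∀ {v a b} → Shared A B v → Private A B a → Private A B b → a ≡ b
  private-vertex-unique {v} {a} {b} v-shared a-priv b-priv with Es A v a in va | Es A v b in vb
  ... | true  | true  =
    A-neighbours-off-B-unique (proj₂ v-shared) va vb (Es-outside B (proj₂ a-priv)) (Es-outside B (proj₂ b-priv))
  ... | false | false = partner-unique (shared-non-neighbour-partnered v-shared a-priv va)
                                       (shared-non-neighbour-partnered v-shared b-priv vb)
  ... | false | true  = private-vertex-unique-via-partner v-shared a-priv b-priv va vb
  ... | true  | false = sym (private-vertex-unique-via-partner v-shared b-priv a-priv vb va)

  -- Otherwise w and x are two A-neighbours of u off B or, x being the A-partner of u, u and x are two
  -- such neighbours of w.
  A-edge⇒B-edge : ∀ {x u w} → Private A B x → Vs B u ≡ true → Vs B w ≡ true → Es A u w ≡ true → Es B u w ≡ true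
  A-edge⇒B-edge {x} {u} {w} (x∈A , x∉B) u∈B w∈B uw with Es B u w in uw∉B
  ... | true  = refl
  ... | false with Es A u x in ux
  ...   | true  = ⊥-elim (≢-by (Vs B) w∈B x∉B (A-neighbours-off-B-unique u∈B uw ux uw∉B (Es-outside B x∉B)))
  ...   | false = ⊥-elim (≢-by (Vs B) u∈B x∉B
                   (A-neighbours-off-B-unique w∈B (Es-flip A uw) (Es-flip A xw) (Es-flip B uw∉B) (Es-outside B x∉B)))
    where
    xw : Es A x w ≡ true
    xw = partner-shares-neighbours (proj₁ (Es-ends A u w uw) , x∈A , ≢-by (Vs B) u∈B x∉B , ux) uw

module OnePrivateVertex {n} {G : SimpleGraph n} {p} (3≤p : 3 ≤ p) (A B : Subgraph G) {f g : K2-V p → Fin n}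
  (isoA : IsoOnto (K2-V p) (K2-adj p) (Vs A) (Es A) f) (isoB : IsoOnto (K2-V p) (K2-adj p) (Vs B) (Es B) g)
  (A-extra : AtMostOneExtraNeighbour A) (B-extra : AtMostOneExtraNeighbour B) {x} (x-priv : Private A B x) where

  open PrivateVertex 3≤p A B isoA B-extra
  private
    module BA = PrivateVertex 3≤p B A isoB A-extra
    module Ac = K₂Copy A isoA
    module Bc = K₂Copy B isoB

  B-partner-private : ∀ {u w s} → Partners A u w → Es B u w ≡ true → Partners B u s → Vs A s ≡ false
  B-partner-private {u} {w} {s} P uw∈B (u∈B , s∈B , u≢s , us∉B) with Vs A s in As
  ... | false = refl
  ... | true with Es A u s in us
  ...   | true  = ⊥-elim (true≢false (A-edge⇒B-edge x-priv u∈B s∈B us) us∉B)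
  ...   | false = ⊥-elim (true≢false uw∈B (subst (λ y → Es B u y ≡ false) (sym w≡s) us∉B))
    where
    w≡s : w ≡ s
    w≡s = Ac.partner-unique P (proj₁ P , As , u≢s , us)

  -- If u, w were A-partners joined in B, their B-partners would both be private to B, hence equal,
  -- making u and w B-partners of the same vertex.
  B-edge⇒A-edge : ∀ {u w} → Shared A B u → Shared A B w → Es B u w ≡ true → Es A u w ≡ true
  B-edge⇒A-edge {u} {w} (u∈A , u∈B) (w∈A , w∈B) uw∈B with Es A u w in uw
  ... | true  = refl
  ... | false with Bc.partner-exists u∈B | Bc.partner-exists w∈B
  ...   | s , Pu | s′ , Pw = ⊥-elim (Es-≢ B uw∈B (Bc.partner-unique (Partners-sym B Pu) (Partners-sym B Pw′)))
    where
    P : Partners A u w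
    P = u∈A , w∈A , Es-≢ B uw∈B , uw

    s≡s′ : s ≡ s′
    s≡s′ = BA.private-vertex-unique (u∈B , u∈A)
             (proj₁ (proj₂ Pu) , B-partner-private P uw∈B Pu)
             (proj₁ (proj₂ Pw) , B-partner-private (Partners-sym A P) (Es-flip B uw∈B) Pw)

    Pw′ : Partners B w s
    Pw′ = subst (Partners B w) (sym s≡s′) Pw

  shared-edges-agree : ∀ {u w} → Shared A B u → Shared A B w → Es B u w ≡ Es A u w
  shared-edges-agree u-shared w-shared =
    ≡-by-implications (B-edge⇒A-edge u-shared w-shared) (A-edge⇒B-edge x-priv (proj₂ u-shared) (proj₂ w-shared))

  non-private⇒shared : ∀ {v₀ v} → Shared A B v₀ → Vs A v ≡ true → v ≢ x → Vs B v ≡ true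
  non-private⇒shared {v = v} v₀-shared v∈A v≢x with Vs B v in Bv
  ... | true  = refl
  ... | false = ⊥-elim (v≢x (private-vertex-unique v₀-shared (v∈A , Bv) x-priv))

private-vertex⇒∩≅I₁×K₂ : ∀ {n m} {G : SimpleGraph n} → 3 ≤ suc m → (A B : Subgraph G) → ∀ {f g} →
  IsoOnto (K2-V (suc m)) (K2-adj (suc m)) (Vs A) (Es A) f → IsoOnto (K2-V (suc m)) (K2-adj (suc m)) (Vs B) (Es B) g →
  AtMostOneExtraNeighbour A → AtMostOneExtraNeighbour B → ∀ {v₀ x} → Shared A B v₀ → Private A B x →
  Isomorphic (I₁×-V (K2-V m)) (I₁×-adj (K2-adj m)) (∩V A B) (∩E A B)
private-vertex⇒∩≅I₁×K₂ 3≤p A B isoA isoB A-extra B-extra {x = x} v₀-shared x-priv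
  with K₂Copy.f-onto A isoA x (proj₁ x-priv)
... | (c , a) , refl =
  K₂-minus-vertex isoA c a (λ _ → proj₁ ∘ ∧-true) (cong₂ _∧_ (proj₁ x-priv) (proj₂ x-priv))
    (λ v v∈A v≢x → cong₂ _∧_ v∈A (non-private⇒shared v₀-shared v∈A v≢x)) ∩-edges
  where
  open OnePrivateVertex 3≤p A B isoA isoB A-extra B-extra x-priv

  ∩-edges : ∀ u w → ∩V A B u ≡ true → ∩V A B w ≡ true → ∩E A B u w ≡ Es A u w
  ∩-edges u w u∈∩ w∈∩ = begin
    Es A u w ∧ Es B u w  ≡⟨ cong (Es A u w ∧_) (shared-edges-agree (∧-true u∈∩) (∧-true w∈∩)) ⟩
    Es A u w ∧ Es A u w  ≡⟨ Bool.∧-idem _ ⟩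
    Es A u w             ∎
    where open ≡-Reasoning

module SameVertices {n} {G : SimpleGraph n} {p} (H₁ H₂ : Subgraph G) {f₁ f₂ : K2-V p → Fin n}
  (iso₁ : IsoOnto (K2-V p) (K2-adj p) (Vs H₁) (Es H₁) f₁) (iso₂ : IsoOnto (K2-V p) (K2-adj p) (Vs H₂) (Es H₂) f₂)
  (V₁≗V₂ : ∀ v → Vs H₁ v ≡ Vs H₂ v) where

  private
    module C₁ = K₂Copy H₁ iso₁
    module C₂ = K₂Copy H₂ iso₂

  to₂ : ∀ {v} → Vs H₁ v ≡ true → Vs H₂ v ≡ true
  to₂ {v} = trans (sym (V₁≗V₂ v))

  to₁ : ∀ {v} → Vs H₂ v ≡ true → Vs H₁ v ≡ true
  to₁ {v} = trans (V₁≗V₂ v)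

  H₁-partner-adjacent : ∀ {x y₁ y₂} → Partners H₁ x y₁ → Partners H₂ x y₂ → y₁ ≢ y₂ → adj G x y₁ ≡ true
  H₁-partner-adjacent (_ , y₁∈ , x≢y₁ , _) P₂ y₁≢y₂ =
    Es⊆G H₂ _ _ (C₂.non-partner-adjacent P₂ (to₂ y₁∈) x≢y₁ (y₁≢y₂ ∘ sym))

  partners-differ : ¬ (∀ u w → Es H₁ u w ≡ Es H₂ u w) →
                    ∃ λ x → ∃₂ λ y₁ y₂ → Partners H₁ x y₁ × Partners H₂ x y₂ × y₁ ≢ y₂
  partners-differ E₁≉E₂ with differ-somewhere (Es H₁) (Es H₂) E₁≉E₂
  ... | u , w , uw₁≢uw₂ with ≢-cases uw₁≢uw₂
  ...   | inj₁ (uw₁ , uw₂) with C₁.partner-exists (proj₁ (Es-ends H₁ u w uw₁))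
  ...     | y₁ , P₁ = u , y₁ , w , P₁ , P₂ , ≢-by (Es H₁ u) uw₁ (proj₂ (proj₂ (proj₂ P₁))) ∘ sym
    where
    P₂ : Partners H₂ u w
    P₂ = to₂ (proj₁ (Es-ends H₁ u w uw₁)) , to₂ (proj₂ (Es-ends H₁ u w uw₁)) , Es-≢ H₁ uw₁ , uw₂
  partners-differ E₁≉E₂ | u , w , _ | inj₂ (uw₁ , uw₂) with C₂.partner-exists (proj₁ (Es-ends H₂ u w uw₂))
  ...     | y₂ , P₂ = u , w , y₂ , P₁ , P₂ , ≢-by (Es H₂ u) uw₂ (proj₂ (proj₂ (proj₂ P₂)))
    where
    P₁ : Partners H₁ u w
    P₁ = to₁ (proj₁ (Es-ends H₂ u w uw₂)) , to₁ (proj₂ (Es-ends H₂ u w uw₂)) , Es-≢ H₂ uw₂ , uw₁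

  -- The two classes are those in H₁ of x and of its H₂-partner y₂.
  two-classes-induce-edges : ¬ SameSubgraph H₁ H₂ →
    Σ (Fin p) λ i → Σ (Fin p) λ j → ¬ i ≡ j
      × adj G (f₁ (i , zero)) (f₁ (i , suc zero)) ≡ true
      × adj G (f₁ (j , zero)) (f₁ (j , suc zero)) ≡ true
  two-classes-induce-edges H₁≠H₂ with partners-differ (λ E₁≗E₂ → H₁≠H₂ (V₁≗V₂ , E₁≗E₂))
  ... | x , y₁ , y₂ , P₁ , P₂ , y₁≢y₂ with C₁.f-onto x (proj₁ P₁) | C₁.f-onto y₂ (to₁ (proj₁ (proj₂ P₂)))
  ...   | (i , a) , refl | (j , b) , refl with C₁.partner-exists (C₁.f∈H (j , b))
  ...     | z , Q₁ =
    i , j , C₁.edge⇒classes-differ xy₂ ,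
    C₁.class-edge P₁ (H₁-partner-adjacent P₁ P₂ y₁≢y₂) ,
    C₁.class-edge Q₁ (H₁-partner-adjacent Q₁ (Partners-sym H₂ P₂) z≢x)
    where
    xy₂ : Es H₁ (f₁ (i , a)) (f₁ (j , b)) ≡ true
    xy₂ = C₁.non-partner-adjacent P₁ (C₁.f∈H _) (proj₁ (proj₂ (proj₂ P₂))) (y₁≢y₂)

    z≢x : z ≢ f₁ (i , a)
    z≢x refl = y₁≢y₂ (C₁.partner-unique P₁ (Partners-sym H₁ Q₁))

lemma8 : (p : ℕ) → 3 ≤ p → (t : ℕ) → t ≡ 2 * p ∸ 2 →
    ∀ {n} (G : SimpleGraph n) → (∀ v → degree G v ≤ t + 1) →
    (H₁ H₂ : Subgraph G) → IsK2 p H₁ → IsK2 p H₂ → ¬ SameSubgraph H₁ H₂ →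
    (∃ λ v → Vs H₁ v ≡ true × Vs H₂ v ≡ true) →
    Isomorphic (I₁×-V (K2-V (p ∸ 1))) (I₁×-adj (K2-adj (p ∸ 1))) (∩V H₁ H₂) (∩E H₁ H₂)
    ⊎ ((∀ v → Vs H₁ v ≡ Vs H₂ v)
       × Σ (K2-V p → Fin n) λ f → IsoOnto (K2-V p) (K2-adj p) (Vs H₁) (Es H₁) f
         × Σ (Fin p) λ i → Σ (Fin p) λ j → ¬ i ≡ j
           × adj G (f (i , zero)) (f (i , suc zero)) ≡ true
           × adj G (f (j , zero)) (f (j , suc zero)) ≡ true)
lemma8 zero ()
lemma8 (suc m) 3≤p t refl G deg H₁ H₂ (f₁ , iso₁) (_ , iso₂) H₁≠H₂ (_ , v₀∈₁ , v₀∈₂) =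
  case compare-vertex-sets H₁ H₂ of λ
    { (inj₁ V₁≗V₂) →
        inj₂ (V₁≗V₂ , f₁ , iso₁ , SameVertices.two-classes-induce-edges H₁ H₂ iso₁ iso₂ V₁≗V₂ H₁≠H₂)
    ; (inj₂ (inj₁ (_ , x-priv))) →
        inj₁ (private-vertex⇒∩≅I₁×K₂ 3≤p H₁ H₂ iso₁ iso₂ extra₁ extra₂ (v₀∈₁ , v₀∈₂) x-priv)
    ; (inj₂ (inj₂ (_ , x-priv))) →
        inj₁ (Isomorphic-resp (λ v → Bool.∧-comm (Vs H₂ v) (Vs H₁ v)) (λ u w → Bool.∧-comm (Es H₂ u w) (Es H₁ u w))
               (private-vertex⇒∩≅I₁×K₂ 3≤p H₂ H₁ iso₂ iso₁ extra₂ extra₁ (v₀∈₂ , v₀∈₁) x-priv))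
    }
  where
  deg′ : ∀ v → degree G v ≤ m * 2 + 1
  deg′ v = subst (λ d → degree G v ≤ d ∸ 2 + 1) (*-comm 2 (suc m)) (deg v)

  extra₁ : AtMostOneExtraNeighbour H₁
  extra₁ = bounded-degree⇒AtMostOneExtraNeighbour H₁ iso₁ deg′

  extra₂ : AtMostOneExtraNeighbour H₂
  extra₂ = bounded-degree⇒AtMostOneExtraNeighbour H₂ iso₂ deg′
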